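{- Let $G,H$ be connected graphs, each of order at least $3$. Then $sdiam_3(G\Box H)=sdiam_3(G)+sdiam_3(H)$.
   Context: For a connected graph $F$ and $S\subseteq V(F)$, the Steiner distance $d_F(S)$ is the minimum number of edges of a connected subgraph of $F$ whose vertex set contains $S$. For $2\le k\le |V(F)|$, $sdiam_k(F)=\max\{d_F(S): S\subseteq V(F),\ |S|=k\}$. The Cartesian product $G\Box H$ has vertex set $V(G)\times V(H)$, with $(g,h)\sim(g',h')$ iff either $g=g'$ and $hh'\in E(H)$, or $h=h'$ and $gg'\in E(G)$. -}

module Defs where

open import Level using (0ℓ)
open import Data.Nat using (ℕ; _≤_)
open import Data.Fin using (Fin)
open import Data.Product using (_×_; _,_; ∃; Σ-syntax)
open import Data.Sum using (_⊎_)
open import Data.List using (List; length)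
open import Data.List.Membership.Propositional using (_∈_)
open import Data.List.Relation.Unary.All using (All)
open import Data.List.Relation.Unary.AllPairs using (AllPairs)
open import Data.List.Relation.Unary.Unique.Propositional using (Unique)
open import Relation.Binary.PropositionalEquality using (_≡_; _≢_)
open import Relation.Binary.Construct.Closure.ReflexiveTransitive using (Star)
open import Relation.Nullary using (¬_)

record Graph (V : Set) : Set₁ where
  field
    Adj    : V → V → Set
    sym    : ∀ {x y} → Adj x y → Adj y x
    irrefl : ∀ {x} → ¬ Adj x x
open Graph public

FinGraph : ℕ → Set₁
FinGraph n = Graph (Fin n)

Connected : ∀ {V} → Graph V → Set
Connected G = ∀ x y → Star (Adj G) x y

_□_ : ∀ {V W} → Graph V → Graph W → Graph (V × W)
Adj (G □ H) (g , h) (g' , h') =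
  (g ≡ g' × Adj H h h') ⊎ (h ≡ h' × Adj G g g')
sym (G □ H) (Data.Sum.inj₁ (refl' , a)) = Data.Sum.inj₁ (Relation.Binary.PropositionalEquality.sym refl' , Graph.sym H a)
sym (G □ H) (Data.Sum.inj₂ (refl' , a)) = Data.Sum.inj₂ (Relation.Binary.PropositionalEquality.sym refl' , Graph.sym G a)
irrefl (G □ H) (Data.Sum.inj₁ (_ , a)) = irrefl H a
irrefl (G □ H) (Data.Sum.inj₂ (_ , a)) = irrefl G a

SameEdge : ∀ {V : Set} → V × V → V × V → Set
SameEdge (x , y) (x' , y') = (x ≡ x' × y ≡ y') ⊎ (x ≡ y' × y ≡ x')

EdgeIn : ∀ {V : Set} → List (V × V) → V → V → Set
EdgeIn E x y = ((x , y) ∈ E) ⊎ ((y , x) ∈ E)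

-- A connected subgraph of G with vertex list U and edge list E
-- (distinct undirected edges of G, endpoints in U), containing S,
-- having exactly d edges.
record ConnSubgraph {V : Set} (G : Graph V) (S : List V) (d : ℕ) : Set where
  field
    U         : List V
    E         : List (V × V)
    edgesAdj  : All (λ e → Adj G (Data.Product.proj₁ e) (Data.Product.proj₂ e)) E
    edgesInU  : All (λ e → (Data.Product.proj₁ e ∈ U) × (Data.Product.proj₂ e ∈ U)) E
    edgesDist : AllPairs (λ e f → ¬ SameEdge e f) E
    connected : ∀ x y → x ∈ U → y ∈ U → Star (EdgeIn E) x y
    containsS : All (_∈ U) S
    size      : length E ≡ d

SteinerDist : ∀ {V : Set} → Graph V → List V → ℕ → Set
SteinerDist G S d = ConnSubgraph G S d × (∀ d' → ConnSubgraph G S d' → d ≤ d')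

KSubset : ∀ {V : Set} → ℕ → List V → Set
KSubset k S = Unique S × length S ≡ k

IsSdiam : ∀ {V : Set} → ℕ → Graph V → ℕ → Set
IsSdiam k G D =
  (∃ λ S → KSubset k S × SteinerDist G S D) ×
  (∀ S d → KSubset k S → SteinerDist G S d → d ≤ D)

module Submission where

-- Every edge of G □ H changes exactly one coordinate, so the
-- projections to G and H are weak homomorphisms (edges go to edges or
-- collapse) and every edge survives in exactly one of them.  Projecting a
-- connected subgraph through S therefore yields connected subgraphs through
-- the coordinates of S whose sizes add up to at most its own size.  Pairing
-- 3-subsets realising sdiam₃(G) = a and sdiam₃(H) = b gives a 3-subset of
-- G □ H at Steiner distance exactly a + b.
--
-- For a triple (gᵢ , hᵢ) take subgraphs T₁ ⊆ G, T₂ ⊆ H through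
-- the gᵢ, hᵢ with at most a, b edges.  By the median lemma some c carries
-- walks from g₁, g₂, g₃ in T₁ of total length ≤ |T₁|; a copy of T₂ in the
-- layer {c} × H and these walks in the layers G × {hᵢ} give at most a + b
-- edges through the triple.

open import Defs
open import Level using (0ℓ)
open import Function using (id; _∘_)
open import Data.Empty using (⊥-elim)
open import Data.Nat using (ℕ; zero; suc; _+_; _≤_; _<_; z≤n; s≤s; _≤?_)
open import Data.Nat.Properties
  using (≤-refl; ≤-trans; ≤-antisym; ≰⇒>; +-mono-≤; +-monoʳ-≤; +-suc; +-assoc; +-comm; module ≤-Reasoning)
open import Data.Fin using (Fin; zero; suc) renaming (_≟_ to _≟ᶠ_)
open import Data.Product using (Σ; ∃; _×_; _,_; proj₁; proj₂)
import Data.Product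
open import Data.Product.Properties using (≡-dec)
open import Data.Sum using (_⊎_; inj₁; inj₂; [_,_])
import Data.Sum
open import Data.List using (List; []; _∷_; _++_; length; map; deduplicate)
open import Data.List.Properties using (length-++; length-filter; length-removeAt′)
open import Data.List.Membership.Propositional using (_∈_; _∉_)
open import Data.List.Membership.Propositional.Properties using (∈-++⁺ˡ; ∈-++⁺ʳ; ∈-++⁻; ∈-map⁺; ∈-map⁻)
open import Data.List.Relation.Unary.Any as Any using (Any; here; there; _─_)
import Data.List.Relation.Unary.Any.Properties as Anyₚ
open import Data.List.Relation.Unary.All as All using (All; []; _∷_)
open import Data.List.Relation.Unary.All.Properties using (¬Any⇒All¬; All¬⇒¬Any)
import Data.List.Relation.Unary.All.Properties as Allₚ
open import Data.List.Relation.Unary.AllPairs using (AllPairs; []; _∷_)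
import Data.List.Relation.Unary.AllPairs.Properties as AllPairsₚ
open import Data.List.Relation.Unary.Unique.Propositional using (Unique)
import Data.List.Relation.Unary.Unique.Propositional.Properties as Uniqueₚ
open import Data.List.Relation.Unary.Unique.DecSetoid.Properties using (deduplicate-!)
open import Relation.Binary using (DecidableEquality; DecSetoid)
open import Relation.Binary.PropositionalEquality as ≡ using (_≡_; _≢_; refl)
open import Relation.Binary.Construct.Closure.ReflexiveTransitive
  using (Star; ε; _◅_; _◅◅_; reverse) renaming (map to Star-map)
open import Relation.Nullary using (¬_; Dec; yes; no; ¬?)
open import Relation.Nullary.Decidable using (_×-dec_; _⊎-dec_; decidable-stable)
open import Relation.Nullary.Negation using (¬¬-map)

module DistinctCount {A : Set} (_≈_ : A → A → Set)
                     (euclid : ∀ {x y z} → x ≈ z → y ≈ z → x ≈ y) where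

  ─-keeps : ∀ {x y ys} (p : Any (x ≈_) ys) → Any (y ≈_) ys → ¬ x ≈ y → Any (y ≈_) (ys ─ p)
  ─-keeps (here x≈f)  (here y≈f) x≉y = ⊥-elim (x≉y (euclid x≈f y≈f))
  ─-keeps (here _)    (there q)  _   = q
  ─-keeps (there _)   (here y≈f) _   = here y≈f
  ─-keeps (there p)   (there q)  x≉y = there (─-keeps p q x≉y)

  distinct-length≤ : ∀ {xs ys} → AllPairs (λ x y → ¬ x ≈ y) xs →
                     All (λ x → Any (x ≈_) ys) xs → length xs ≤ length ys
  distinct-length≤ []               []       = z≤n
  distinct-length≤ {_ ∷ xs} {ys} (x≉ ∷ d) (p ∷ ps) = begin
    suc (length xs)         ≤⟨ s≤s (distinct-length≤ d (All.zipWith (λ (q , n) → ─-keeps p q n) (ps , x≉))) ⟩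
    suc (length (ys ─ p))   ≡⟨ ≡.sym (length-removeAt′ ys (Any.index p)) ⟩
    length ys               ∎
    where open ≤-Reasoning

module _ {V : Set} where

  sameEdge-refl : ∀ {e : V × V} → SameEdge e e
  sameEdge-refl = inj₁ (refl , refl)

  sameEdge-sym : ∀ {e f : V × V} → SameEdge e f → SameEdge f e
  sameEdge-sym (inj₁ (refl , refl)) = inj₁ (refl , refl)
  sameEdge-sym (inj₂ (refl , refl)) = inj₂ (refl , refl)

  sameEdge-trans : ∀ {e f g : V × V} → SameEdge e f → SameEdge f g → SameEdge e g
  sameEdge-trans (inj₁ (refl , refl)) s                    = s
  sameEdge-trans (inj₂ (refl , refl)) (inj₁ (refl , refl)) = inj₂ (refl , refl)
  sameEdge-trans (inj₂ (refl , refl)) (inj₂ (refl , refl)) = inj₁ (refl , refl)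

  sameEdge-euclid : ∀ {e f g : V × V} → SameEdge e g → SameEdge f g → SameEdge e f
  sameEdge-euclid s t = sameEdge-trans s (sameEdge-sym t)

  EdgeIn⇒Any : ∀ {E : List (V × V)} {x y} → EdgeIn E x y → Any (SameEdge (x , y)) E
  EdgeIn⇒Any (inj₁ m) = Any.map (λ { refl → inj₁ (refl , refl) }) m
  EdgeIn⇒Any (inj₂ m) = Any.map (λ { refl → inj₂ (refl , refl) }) m

  Any⇒EdgeIn : ∀ {E : List (V × V)} {x y} → Any (SameEdge (x , y)) E → EdgeIn E x y
  Any⇒EdgeIn (here (inj₁ (refl , refl))) = inj₁ (here refl)
  Any⇒EdgeIn (here (inj₂ (refl , refl))) = inj₂ (here refl)
  Any⇒EdgeIn (there m) = Data.Sum.map there there (Any⇒EdgeIn m)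

  EdgeIn-sym : ∀ {E : List (V × V)} {x y} → EdgeIn E x y → EdgeIn E y x
  EdgeIn-sym = Data.Sum.swap

module _ {V : Set} {R : V → V → Set} where

  verts : ∀ {x y} → Star R x y → List V
  verts {x} ε       = x ∷ []
  verts {x} (_ ◅ p) = x ∷ verts p

  edges : ∀ {x y} → Star R x y → List (V × V)
  edges ε                     = []
  edges {x} (_◅_ {j = w} _ p) = (x , w) ∷ edges p

  len : ∀ {x y} → Star R x y → ℕ
  len p = length (edges p)

  head∈ : ∀ {x y} (p : Star R x y) → x ∈ verts p
  head∈ ε       = here refl
  head∈ (_ ◅ _) = here refl

  last∈ : ∀ {x y} (p : Star R x y) → y ∈ verts p
  last∈ ε       = here refl
  last∈ (_ ◅ p) = there (last∈ p)

  edges-step : ∀ {x y} (p : Star R x y) → All (λ e → R (proj₁ e) (proj₂ e)) (edges p)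
  edges-step ε       = []
  edges-step (r ◅ p) = r ∷ edges-step p

  edges-verts : ∀ {x y} (p : Star R x y) →
                All (λ e → proj₁ e ∈ verts p × proj₂ e ∈ verts p) (edges p)
  edges-verts ε       = []
  edges-verts (_ ◅ p) =
    (here refl , there (head∈ p)) ∷ All.map (Data.Product.map there there) (edges-verts p)

  path-edges-distinct : ∀ {x y} (p : Star R x y) → Unique (verts p) →
                        AllPairs (λ e f → ¬ SameEdge e f) (edges p)
  path-edges-distinct ε       _          = []
  path-edges-distinct (_ ◅ p) (x∉ ∷ uniq) =
    All.map (fresh-start (All¬⇒¬Any x∉)) (edges-verts p) ∷ path-edges-distinct p uniq
    where
    fresh-start : ∀ {x w e} → x ∉ verts p → proj₁ e ∈ verts p × proj₂ e ∈ verts p →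
                  ¬ SameEdge (x , w) e
    fresh-start x∉ (a , _) (inj₁ (refl , _)) = x∉ a
    fresh-start x∉ (_ , b) (inj₂ (refl , _)) = x∉ b

  suffix : ∀ {w y x} (q : Star R w y) → x ∈ verts q →
           Σ (Star R x y) λ s → (Unique (verts q) → Unique (verts s)) ×
                                (∀ {P : V × V → Set} → All P (edges q) → All P (edges s))
  suffix ε       (here refl) = ε , id , id
  suffix (r ◅ q) (here refl) = r ◅ q , id , id
  suffix (_ ◅ q) (there x∈) =
    let s , uniq , sub = suffix q x∈ in s , (λ { (_ ∷ u) → uniq u }) , (λ { (_ ∷ a) → sub a })

  split : ∀ {x y c} (p : Star R x y) → c ∈ verts p →
          Σ (Star R x c) λ p₁ → Σ (Star R c y) λ p₂ → len p₁ + len p₂ ≡ len p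
  split ε       (here refl) = ε , ε , refl
  split (r ◅ p) (here refl) = ε , r ◅ p , refl
  split (r ◅ p) (there c∈) =
    let p₁ , p₂ , eq = split p c∈ in r ◅ p₁ , p₂ , ≡.cong suc eq

module Shortcuts {V : Set} (_≟_ : DecidableEquality V) where

  open import Data.List.Membership.DecPropositional _≟_ using (_∈?_)

  to-path : ∀ {R : V → V → Set} {x y} → Star R x y → Σ (Star R x y) (Unique ∘ verts)
  to-path ε = ε , [] ∷ []
  to-path {x = x} (r ◅ p) with to-path p
  ... | q , uq with x ∈? verts q
  ...   | yes x∈ = let s , uniq , _ = suffix q x∈ in s , uniq uq
  ...   | no  x∉ = r ◅ q , ¬Any⇒All¬ _ x∉ ∷ uq

  first-entry : ∀ {R : V → V → Set} (X : List V) {z t} → Star R z t → t ∈ X →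
                Σ V λ c → c ∈ X × Σ (Star R z c) λ q →
                  Unique (verts q) × All (λ e → proj₁ e ∉ X) (edges q)
  first-entry X {z} ε t∈ = z , t∈ , ε , [] ∷ [] , []
  first-entry X {z} (r ◅ p) t∈ with z ∈? X
  ... | yes z∈ = z , z∈ , ε , [] ∷ [] , []
  ... | no  z∉ with first-entry X p t∈
  ...   | c , c∈ , q , uq , out with z ∈? verts q
  ...     | yes z∈q = let s , uniq , sub = suffix q z∈q in c , c∈ , s , uniq uq , sub out
  ...     | no  z∉q = c , c∈ , r ◅ q , ¬Any⇒All¬ _ z∉q ∷ uq , z∉ ∷ out

  -- If x, y, z are joined by walks in the edge list E, some c
  -- has walks from x, y, z to c whose lengths sum to at most |E|: take a
  -- path P from x to y and a path from z that first enters P at c.  Their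
  -- edges are pairwise distinct and all listed in E.
  median : ∀ {E : List (V × V)} {x y z} → Star (EdgeIn E) x y → Star (EdgeIn E) z x →
           Σ V λ c → Σ (Star (EdgeIn E) x c) λ p₁ → Σ (Star (EdgeIn E) c y) λ p₂ →
           Σ (Star (EdgeIn E) z c) λ q → len p₁ + len p₂ + len q ≤ length E
  median {E} x⇝y z⇝x with to-path x⇝y
  ... | P , uP with first-entry (verts P) z⇝x (head∈ P)
  ... | c , c∈ , q , uq , out with split P c∈
  ... | p₁ , p₂ , split-len = c , p₁ , p₂ , q , bound
    where
    -- q's edges start outside P, P's edges lie inside P
    apart : All (λ e → All (λ f → ¬ SameEdge e f) (edges q)) (edges P)
    apart = All.map (λ (a , b) → All.map (λ f∉ s → f∉ (start∈ a b s)) out) (edges-verts P)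
      where
      start∈ : ∀ {e f : V × V} → proj₁ e ∈ verts P → proj₂ e ∈ verts P →
               SameEdge e f → proj₁ f ∈ verts P
      start∈ a _ (inj₁ (refl , _)) = a
      start∈ _ b (inj₂ (_ , refl)) = b
    open DistinctCount SameEdge sameEdge-euclid
    bound : len p₁ + len p₂ + len q ≤ length E
    bound = begin
      len p₁ + len p₂ + len q       ≡⟨ ≡.cong (_+ len q) split-len ⟩
      len P + len q                 ≡⟨ ≡.sym (length-++ (edges P)) ⟩
      length (edges P ++ edges q)
        ≤⟨ distinct-length≤ (AllPairsₚ.++⁺ (path-edges-distinct P uP) (path-edges-distinct q uq) apart)
                            (All.map EdgeIn⇒Any (Allₚ.++⁺ (edges-step P) (edges-step q))) ⟩
      length E                      ∎
      where open ≤-Reasoning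

module EdgeDedup {V : Set} (_≟_ : DecidableEquality V) where

  sameEdge? : (e f : V × V) → Dec (SameEdge e f)
  sameEdge? (a , b) (c , d) = ((a ≟ c) ×-dec (b ≟ d)) ⊎-dec ((a ≟ d) ×-dec (b ≟ c))

  edgeDecSetoid : DecSetoid 0ℓ 0ℓ
  edgeDecSetoid = record
    { Carrier          = V × V
    ; _≈_              = SameEdge
    ; isDecEquivalence = record
      { isEquivalence = record { refl = sameEdge-refl ; sym = sameEdge-sym ; trans = sameEdge-trans }
      ; _≟_           = sameEdge? } }

  dedup : List (V × V) → List (V × V)
  dedup = deduplicate sameEdge?

  dedup-distinct : ∀ E → AllPairs (λ e f → ¬ SameEdge e f) (dedup E)
  dedup-distinct = deduplicate-! edgeDecSetoid

  dedup-length : ∀ E → length (dedup E) ≤ length E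
  dedup-length []      = z≤n
  dedup-length (e ∷ E) = s≤s (≤-trans (length-filter (¬? ∘ sameEdge? e) (dedup E)) (dedup-length E))

  dedup-EdgeIn : ∀ {E x y} → EdgeIn E x y → EdgeIn (dedup E) x y
  dedup-EdgeIn = Any⇒EdgeIn ∘ Anyₚ.deduplicate⁺ sameEdge? respects ∘ EdgeIn⇒Any
    where
    respects : ∀ {e f g : V × V} → SameEdge g f → SameEdge e f → SameEdge e g
    respects g≈f e≈f = sameEdge-euclid e≈f g≈f

GraphEdges : ∀ {V : Set} → Graph V → List (V × V) → Set
GraphEdges G = All (λ e → Adj G (proj₁ e) (proj₂ e))

-- Networks glue together easily; deduplicating the edges of a network gives
-- a connected subgraph in the sense of ConnSubgraph.
record Net {V : Set} (G : Graph V) (r : V) : Set where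
  field
    U     : List V
    E     : List (V × V)
    adj   : GraphEdges G E
    inU   : All (λ e → proj₁ e ∈ U × proj₂ e ∈ U) E
    reach : ∀ {u} → u ∈ U → Star (EdgeIn E) r u
open Net

module _ {V : Set} {G : Graph V} where

  glue : ∀ {r r′ v} (N : Net G r) (N′ : Net G r′) → v ∈ U N → v ∈ U N′ → Net G r
  glue N N′ v∈N v∈N′ = record
    { U     = U N ++ U N′
    ; E     = E N ++ E N′
    ; adj   = Allₚ.++⁺ (adj N) (adj N′)
    ; inU   = Allₚ.++⁺ (All.map (Data.Product.map ∈-++⁺ˡ ∈-++⁺ˡ) (inU N))
                       (All.map (Data.Product.map (∈-++⁺ʳ (U N)) (∈-++⁺ʳ (U N))) (inU N′))
    ; reach = [ left ∘ reach N
              , (λ u∈N′ → left (reach N v∈N) ◅◅ right (reverse EdgeIn-sym (reach N′ v∈N′) ◅◅ reach N′ u∈N′))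
              ] ∘ ∈-++⁻ (U N)
    }
    where
    left : ∀ {x y} → Star (EdgeIn (E N)) x y → Star (EdgeIn (E N ++ E N′)) x y
    left = Star-map (Data.Sum.map ∈-++⁺ˡ ∈-++⁺ˡ)
    right : ∀ {x y} → Star (EdgeIn (E N′)) x y → Star (EdgeIn (E N ++ E N′)) x y
    right = Star-map (Data.Sum.map (∈-++⁺ʳ (E N)) (∈-++⁺ʳ (E N)))

  edgeIn-adj : ∀ {E} → GraphEdges G E → ∀ {x y} → EdgeIn E x y → Adj G x y
  edgeIn-adj as (inj₁ m) = All.lookup as m
  edgeIn-adj as (inj₂ m) = Graph.sym G (All.lookup as m)

  walk-net : ∀ {R : V → V → Set} → (∀ {a b} → R a b → Adj G a b) → ∀ {x y} → Star R x y → Net G x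
  walk-net toAdj p = record
    { U = verts p ; E = edges p ; adj = All.map toAdj (edges-step p) ; inU = edges-verts p
    ; reach = walk-reach p }
    where
    walk-reach : ∀ {x y} (p : Star _ x y) {u} → u ∈ verts p → Star (EdgeIn (edges p)) x u
    walk-reach ε       (here refl) = ε
    walk-reach (_ ◅ _) (here refl) = ε
    walk-reach (_ ◅ p) (there u∈)  = inj₁ (here refl) ◅ Star-map (Data.Sum.map there there) (walk-reach p u∈)

  subgraph-net : ∀ {S k} (T : ConnSubgraph G S k) {r} → r ∈ ConnSubgraph.U T → Net G r
  subgraph-net T r∈ = record
    { U = ConnSubgraph.U T ; E = ConnSubgraph.E T ; adj = ConnSubgraph.edgesAdj T
    ; inU = ConnSubgraph.edgesInU T ; reach = ConnSubgraph.connected T _ _ r∈ }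

  net-subgraph : DecidableEquality V → ∀ {r} (N : Net G r) {S} → All (_∈ U N) S →
                 Σ ℕ λ k → ConnSubgraph G S k × k ≤ length (E N)
  net-subgraph _≟_ N {S} S⊆U = length (dedup (E N)) , subgraph , dedup-length (E N)
    where
    open EdgeDedup _≟_
    subgraph : ConnSubgraph G S _
    subgraph = record
      { U         = U N
      ; E         = dedup (E N)
      ; edgesAdj  = Allₚ.deduplicate⁺ sameEdge? (adj N)
      ; edgesInU  = Allₚ.deduplicate⁺ sameEdge? (inU N)
      ; edgesDist = dedup-distinct (E N)
      ; connected = λ x y x∈ y∈ → Star-map dedup-EdgeIn (reverse EdgeIn-sym (reach N x∈) ◅◅ reach N y∈)
      ; containsS = S⊆U
      ; size      = refl
      }

  subgraph-⊆ : ∀ {S L k} → ConnSubgraph G S k → All (_∈ S) L → ConnSubgraph G L k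
  subgraph-⊆ T L⊆S = record
    { U = ConnSubgraph.U T ; E = ConnSubgraph.E T ; edgesAdj = ConnSubgraph.edgesAdj T
    ; edgesInU = ConnSubgraph.edgesInU T ; edgesDist = ConnSubgraph.edgesDist T
    ; connected = ConnSubgraph.connected T
    ; containsS = All.map (All.lookup (ConnSubgraph.containsS T)) L⊆S
    ; size = ConnSubgraph.size T }

WeakHom : ∀ {V V′ : Set} → Graph V → Graph V′ → (V → V′) → Set
WeakHom G G′ π = ∀ {x y} → Adj G x y → π x ≡ π y ⊎ Adj G′ (π x) (π y)

Hom : ∀ {V V′ : Set} → Graph V → Graph V′ → (V → V′) → Set
Hom G G′ ι = ∀ {x y} → Adj G x y → Adj G′ (ι x) (ι y)

module Push {V V′ : Set} (G : Graph V) (G′ : Graph V′) (π : V → V′) (weak : WeakHom G G′ π) where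

  push : (E : List (V × V)) → GraphEdges G E → List (V′ × V′)
  push []      []       = []
  push (e ∷ E) (a ∷ as) with weak a
  ... | inj₁ _ = push E as
  ... | inj₂ _ = (π (proj₁ e) , π (proj₂ e)) ∷ push E as

  push-adj : ∀ {E} (as : GraphEdges G E) → GraphEdges G′ (push E as)
  push-adj []       = []
  push-adj (a ∷ as) with weak a
  ... | inj₁ _  = push-adj as
  ... | inj₂ a′ = a′ ∷ push-adj as

  push-inside : ∀ {U E} (as : GraphEdges G E) → All (λ e → proj₁ e ∈ U × proj₂ e ∈ U) E →
                All (λ e → proj₁ e ∈ map π U × proj₂ e ∈ map π U) (push E as)
  push-inside []       []       = []
  push-inside (a ∷ as) ((i , j) ∷ ins) with weak a
  ... | inj₁ _ = push-inside as ins
  ... | inj₂ _ = (∈-map⁺ π i , ∈-map⁺ π j) ∷ push-inside as ins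

  push-∈ : ∀ {E x y} (as : GraphEdges G E) → (x , y) ∈ E → π x ≡ π y ⊎ (π x , π y) ∈ push E as
  push-∈ (a ∷ as) (here refl) with weak a
  ... | inj₁ eq = inj₁ eq
  ... | inj₂ _  = inj₂ (here refl)
  push-∈ (a ∷ as) (there m) with weak a
  ... | inj₁ _ = push-∈ as m
  ... | inj₂ _ = Data.Sum.map₂ there (push-∈ as m)

  push-step : ∀ {E x y} (as : GraphEdges G E) → EdgeIn E x y →
              π x ≡ π y ⊎ EdgeIn (push E as) (π x) (π y)
  push-step as (inj₁ m) = Data.Sum.map id inj₁ (push-∈ as m)
  push-step as (inj₂ m) = Data.Sum.map ≡.sym inj₂ (push-∈ as m)

  push-walk : ∀ {E x y} (as : GraphEdges G E) → Star (EdgeIn E) x y →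
              Star (EdgeIn (push E as)) (π x) (π y)
  push-walk as ε = ε
  push-walk as (s ◅ p) with push-step as s
  ... | inj₁ eq = ≡.subst (λ z → Star (EdgeIn (push _ as)) z (π _)) (≡.sym eq) (push-walk as p)
  ... | inj₂ s′ = s′ ◅ push-walk as p

  push-net : ∀ {r} → Net G r → Net G′ (π r)
  push-net N = record
    { U     = map π (U N)
    ; E     = push (E N) (adj N)
    ; adj   = push-adj (adj N)
    ; inU   = push-inside (adj N) (inU N)
    ; reach = reach′ ∘ ∈-map⁻ π
    }
    where
    reach′ : ∀ {u′} → Σ V (λ u → u ∈ U N × u′ ≡ π u) → Star (EdgeIn (push (E N) (adj N))) (π _) u′
    reach′ (_ , u∈N , refl) = push-walk (adj N) (reach N u∈N)

-- Along a homomorphism nothing collapses: networks are copied edge for edge.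
module PushHom {V V′ : Set} (G : Graph V) (G′ : Graph V′) (ι : V → V′) (hom : Hom G G′ ι) where

  open Push G G′ ι (λ a → inj₂ (hom a))

  copy-net : ∀ {r} → Net G r → Net G′ (ι r)
  copy-net = push-net

  copy-length : ∀ {r} (N : Net G r) → length (E (copy-net N)) ≡ length (E N)
  copy-length N = push-length (adj N)
    where
    push-length : ∀ {E} (as : GraphEdges G E) → length (push E as) ≡ length E
    push-length []       = refl
    push-length (_ ∷ as) = ≡.cong suc (push-length as)

module Product {V W : Set} (_≟V_ : DecidableEquality V) (_≟W_ : DecidableEquality W)
               (G : Graph V) (H : Graph W) where

  -- each edge of G □ H moves exactly one coordinate
  proj₁-weak : WeakHom (G □ H) G proj₁
  proj₁-weak (inj₁ (eq , _)) = inj₁ eq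
  proj₁-weak (inj₂ (_ , a))  = inj₂ a

  proj₂-weak : WeakHom (G □ H) H proj₂
  proj₂-weak (inj₁ (_ , a))  = inj₂ a
  proj₂-weak (inj₂ (eq , _)) = inj₁ eq

  layer₁ : (h : W) → Hom G (G □ H) (_, h)
  layer₁ h a = inj₂ (refl , a)

  layer₂ : (g : V) → Hom H (G □ H) (g ,_)
  layer₂ g a = inj₁ (refl , a)

  module P₁ = Push (G □ H) G proj₁ proj₁-weak
  module P₂ = Push (G □ H) H proj₂ proj₂-weak

  module Layer₁ (h : W) = PushHom G (G □ H) (_, h) (layer₁ h)
  module Layer₂ (g : V) = PushHom H (G □ H) (g ,_) (layer₂ g)

  projections-length : ∀ {E} (as : GraphEdges (G □ H) E) →
                       length (P₁.push E as) + length (P₂.push E as) ≡ length E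
  projections-length []            = refl
  projections-length (inj₁ _ ∷ as) = ≡.trans (+-suc _ _) (≡.cong suc (projections-length as))
  projections-length (inj₂ _ ∷ as) = ≡.cong suc (projections-length as)

  projection-bound : ∀ {s S d} → ConnSubgraph (G □ H) (s ∷ S) d →
    Σ ℕ λ p → Σ ℕ λ q → ConnSubgraph G (map proj₁ (s ∷ S)) p ×
                        ConnSubgraph H (map proj₂ (s ∷ S)) q × p + q ≤ d
  projection-bound T with net-subgraph _≟V_ (P₁.push-net N) (Allₚ.map⁺ (All.map (∈-map⁺ proj₁) S⊆U))
                        | net-subgraph _≟W_ (P₂.push-net N) (Allₚ.map⁺ (All.map (∈-map⁺ proj₂) S⊆U))
    where
    S⊆U = ConnSubgraph.containsS T
    N   = subgraph-net T (All.head S⊆U)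
  ... | p , T₁ , p≤ | q , T₂ , q≤ = p , q , T₁ , T₂ , (begin
    p + q                                                      ≤⟨ +-mono-≤ p≤ q≤ ⟩
    length (P₁.push Eᵀ adjᵀ) + length (P₂.push Eᵀ adjᵀ)        ≡⟨ projections-length adjᵀ ⟩
    length Eᵀ                                                  ≡⟨ ConnSubgraph.size T ⟩
    _                                                          ∎)
    where
    open ≤-Reasoning
    Eᵀ   = ConnSubgraph.E T
    adjᵀ = ConnSubgraph.edgesAdj T

  -- From connected subgraphs T₁ ⊆ G through g₁, g₂, g₃
  -- (A edges) and T₂ ⊆ H through h₁, h₂, h₃ (B edges): a median c of T₁ has
  -- walks from g₁, g₂, g₃ with at most A edges in total; the copy of T₂ in
  -- the layer {c} × H together with these walks in the layers G × {hᵢ} is a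
  -- network through the (gᵢ , hᵢ) with at most A + B edges.
  product-subgraph : ∀ {g₁ g₂ g₃ h₁ h₂ h₃ A B} →
    ConnSubgraph G (g₁ ∷ g₂ ∷ g₃ ∷ []) A → ConnSubgraph H (h₁ ∷ h₂ ∷ h₃ ∷ []) B →
    Σ ℕ λ s → ConnSubgraph (G □ H) ((g₁ , h₁) ∷ (g₂ , h₂) ∷ (g₃ , h₃) ∷ []) s × s ≤ A + B
  product-subgraph {g₁} {g₂} {g₃} {h₁} {h₂} {h₃} {A} {B} T₁ T₂
    with ConnSubgraph.containsS T₁ | ConnSubgraph.containsS T₂
  ... | g₁∈ ∷ g₂∈ ∷ g₃∈ ∷ [] | h₁∈ ∷ h₂∈ ∷ h₃∈ ∷ []
    with Shortcuts.median _≟V_ (ConnSubgraph.connected T₁ g₁ g₂ g₁∈ g₂∈) (ConnSubgraph.connected T₁ g₃ g₁ g₃∈ g₁∈)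
  ... | c , p₁ , p₂ , q , median-len =
    let s , T , s≤ = net-subgraph (≡-dec _≟V_ _≟W_) N S⊆N in s , T , ≤-trans s≤ N-length
    where
    in-layer₁ : (h : W) {x y : V} → Star (EdgeIn (ConnSubgraph.E T₁)) x y → Net (G □ H) (x , h)
    in-layer₁ h p = Layer₁.copy-net h (walk-net (edgeIn-adj {G = G} (ConnSubgraph.edgesAdj T₁)) p)
    in-layer₁-length : (h : W) {x y : V} (p : Star (EdgeIn (ConnSubgraph.E T₁)) x y) →
                       length (E (in-layer₁ h p)) ≡ len p
    in-layer₁-length h p = Layer₁.copy-length h (walk-net (edgeIn-adj {G = G} (ConnSubgraph.edgesAdj T₁)) p)
    Nc = Layer₂.copy-net c (subgraph-net T₂ h₁∈)
    L₁ = in-layer₁ h₁ p₁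
    L₂ = in-layer₁ h₂ p₂
    L₃ = in-layer₁ h₃ q
    N₁ = glue Nc L₁ (∈-map⁺ (c ,_) h₁∈) (∈-map⁺ (_, h₁) (last∈ p₁))
    N₂ = glue N₁ L₂ (∈-++⁺ˡ (∈-map⁺ (c ,_) h₂∈)) (∈-map⁺ (_, h₂) (head∈ p₂))
    N  = glue N₂ L₃ (∈-++⁺ˡ (∈-++⁺ˡ (∈-map⁺ (c ,_) h₃∈))) (∈-map⁺ (_, h₃) (last∈ q))
    S⊆N : All (_∈ U N) ((g₁ , h₁) ∷ (g₂ , h₂) ∷ (g₃ , h₃) ∷ [])
    S⊆N = ∈-++⁺ˡ (∈-++⁺ˡ (∈-++⁺ʳ (U Nc) (∈-map⁺ (_, h₁) (head∈ p₁))))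
        ∷ ∈-++⁺ˡ (∈-++⁺ʳ (U N₁) (∈-map⁺ (_, h₂) (last∈ p₂)))
        ∷ ∈-++⁺ʳ (U N₂) (∈-map⁺ (_, h₃) (head∈ q)) ∷ []
    N-length : length (E N) ≤ A + B
    N-length = begin
      length (E N)                                              ≡⟨ length-++ (E N₂) ⟩
      length (E N₂) + length (E L₃)                             ≡⟨ ≡.cong (_+ length (E L₃)) (length-++ (E N₁)) ⟩
      length (E N₁) + length (E L₂) + length (E L₃)             ≡⟨ ≡.cong (λ k → k + length (E L₂) + length (E L₃)) (length-++ (E Nc)) ⟩
      length (E Nc) + length (E L₁) + length (E L₂) + length (E L₃)
        ≡⟨ ≡.cong₂ _+_ (≡.cong₂ _+_ (≡.cong₂ _+_ T₂-size (in-layer₁-length h₁ p₁)) (in-layer₁-length h₂ p₂))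
                       (in-layer₁-length h₃ q) ⟩
      B + len p₁ + len p₂ + len q                ≡⟨ ≡.cong (_+ len q) (+-assoc B (len p₁) (len p₂)) ⟩
      B + (len p₁ + len p₂) + len q              ≡⟨ +-assoc B (len p₁ + len p₂) (len q) ⟩
      B + (len p₁ + len p₂ + len q)              ≤⟨ +-monoʳ-≤ B median-len ⟩
      B + length (ConnSubgraph.E T₁)             ≡⟨ ≡.cong (B +_) (ConnSubgraph.size T₁) ⟩
      B + A                                      ≡⟨ +-comm B A ⟩
      A + B                                      ∎
      where
      open ≤-Reasoning
      T₂-size = ≡.trans (Layer₂.copy-length c (subgraph-net T₂ h₁∈)) (ConnSubgraph.size T₂)

  projection-lower-bound : ∀ {s S A B d} →
    (∀ p → ConnSubgraph G (map proj₁ (s ∷ S)) p → A ≤ p) →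
    (∀ q → ConnSubgraph H (map proj₂ (s ∷ S)) q → B ≤ q) →
    ConnSubgraph (G □ H) (s ∷ S) d → A + B ≤ d
  projection-lower-bound minG minH T =
    let p , q , T₁ , T₂ , p+q≤d = projection-bound T in ≤-trans (+-mono-≤ (minG p T₁) (minH q T₂)) p+q≤d

¬¬-least : (P : ℕ → Set) → ∀ {k} → P k → ¬ ¬ (Σ ℕ λ d → P d × (∀ d′ → P d′ → d ≤ d′))
¬¬-least P {k} pk no-least = below (suc k) k ≤-refl pk
  where
  below : ∀ b d → d < b → ¬ P d
  below (suc b) d (s≤s d≤b) pd = no-least (d , pd , least)
    where
    least : ∀ d′ → P d′ → d ≤ d′
    least d′ pd′ with d ≤? d′
    ... | yes d≤d′ = d≤d′
    ... | no  d≰d′ = ⊥-elim (below b d′ (≤-trans (≰⇒> d≰d′) d≤b) pd′)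

module _ {V : Set} (_≟_ : DecidableEquality V) {G : Graph V} (connected : Connected G) where

  net-through : (r : V) (S : List V) → Σ (Net G r) λ N → r ∈ U N × All (_∈ U N) S
  net-through r [] = record { U = r ∷ [] ; E = [] ; adj = [] ; inU = [] ; reach = λ { (here refl) → ε } }
                   , here refl , []
  net-through r (s ∷ S) =
    let N , r∈N , S⊆N = net-through r S
        walk = connected r s
    in  glue (walk-net id walk) N (head∈ walk) r∈N
      , ∈-++⁺ˡ (head∈ walk) , ∈-++⁺ˡ (last∈ walk) ∷ All.map (∈-++⁺ʳ (verts walk)) S⊆N

  subgraph-through : (r : V) (S : List V) → Σ ℕ (ConnSubgraph G S)
  subgraph-through r S =
    let N , _ , S⊆N = net-through r S
        k , T , _ = net-subgraph _≟_ N S⊆N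
    in  k , T

fresh : ∀ {k} (u v : Fin (3 + k)) → Σ (Fin (3 + k)) λ w → u ≢ w × v ≢ w
fresh zero             zero             = suc zero , (λ ()) , (λ ())
fresh zero             (suc zero)       = suc (suc zero) , (λ ()) , (λ ())
fresh zero             (suc (suc _))    = suc zero , (λ ()) , (λ ())
fresh (suc zero)       zero             = suc (suc zero) , (λ ()) , (λ ())
fresh (suc zero)       (suc _)          = zero , (λ ()) , (λ ())
fresh (suc (suc _))    zero             = suc zero , (λ ()) , (λ ())
fresh (suc (suc _))    (suc _)          = zero , (λ ()) , (λ ())

pair-in-triple : ∀ {k} (x z : Fin (3 + k)) → Σ (List (Fin (3 + k))) λ T → KSubset 3 T × x ∈ T × z ∈ T
pair-in-triple x z with x ≟ᶠ z
... | yes refl =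
  let w₁ , x≢w₁ , _       = fresh x x
      w₂ , x≢w₂ , w₁≢w₂   = fresh x w₁
  in  x ∷ w₁ ∷ w₂ ∷ [] , ((x≢w₁ ∷ x≢w₂ ∷ []) ∷ (w₁≢w₂ ∷ []) ∷ [] ∷ [] , refl) , here refl , here refl
... | no x≢z =
  let w , x≢w , z≢w = fresh x z
  in  x ∷ z ∷ w ∷ [] , ((x≢z ∷ x≢w ∷ []) ∷ (z≢w ∷ []) ∷ [] ∷ [] , refl) , here refl , there (here refl)

triple-in-triple : ∀ {k} (x y z : Fin (3 + k)) →
                   Σ (List (Fin (3 + k))) λ T → KSubset 3 T × All (_∈ T) (x ∷ y ∷ z ∷ [])
triple-in-triple x y z with x ≟ᶠ y | x ≟ᶠ z | y ≟ᶠ z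
... | yes refl | _        | _        = let T , kT , x∈ , z∈ = pair-in-triple x z in T , kT , x∈ ∷ x∈ ∷ z∈ ∷ []
... | no _     | yes refl | _        = let T , kT , x∈ , y∈ = pair-in-triple x y in T , kT , x∈ ∷ y∈ ∷ x∈ ∷ []
... | no _     | no _     | yes refl = let T , kT , x∈ , y∈ = pair-in-triple x y in T , kT , x∈ ∷ y∈ ∷ y∈ ∷ []
... | no x≢y   | no x≢z   | no y≢z   =
  x ∷ y ∷ z ∷ [] , ((x≢y ∷ x≢z ∷ []) ∷ (y≢z ∷ []) ∷ [] ∷ [] , refl) ,
  here refl ∷ there (here refl) ∷ there (there (here refl)) ∷ []

-- In a connected graph of order ≥ 3 with sdiam₃ = a, any three vertices lie
-- (classically) on a connected subgraph with at most a edges: a Steiner tree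
-- of a 3-subset containing them.
steiner-bound : ∀ {n} {G : FinGraph n} {a} → 3 ≤ n → Connected G → IsSdiam 3 G a →
                (x y z : Fin n) → ¬ ¬ (Σ ℕ λ k → ConnSubgraph G (x ∷ y ∷ z ∷ []) k × k ≤ a)
steiner-bound {G = G} (s≤s (s≤s (s≤s _))) connected (_ , sdiam-max) x y z =
  let T , kT , xyz∈T = triple-in-triple x y z
      _ , T-subgraph  = subgraph-through _≟ᶠ_ connected x T
  in  ¬¬-map (λ (d , Tᵈ , least) → d , subgraph-⊆ Tᵈ xyz∈T , sdiam-max T d kT (Tᵈ , least))
             (¬¬-least (ConnSubgraph G T) T-subgraph)

module _ {n m : ℕ} (G : FinGraph n) (H : FinGraph m) where

  open Product _≟ᶠ_ _≟ᶠ_ G H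

  sdiam-attained : ∀ {a b} → IsSdiam 3 G a → IsSdiam 3 H b →
                   ∃ λ S → KSubset 3 S × SteinerDist (G □ H) S (a + b)
  sdiam-attained {a} {b} ((g₁ ∷ g₂ ∷ g₃ ∷ [] , (g-distinct , refl) , T₁ , least₁) , _)
                         ((h₁ ∷ h₂ ∷ h₃ ∷ [] , (_ , refl) , T₂ , least₂) , _) =
    S , (Uniqueₚ.map⁻ {f = proj₁} {xs = S} g-distinct , refl) ,
    realised (product-subgraph T₁ T₂) , lower
    where
    S = (g₁ , h₁) ∷ (g₂ , h₂) ∷ (g₃ , h₃) ∷ []
    lower : ∀ d → ConnSubgraph (G □ H) S d → a + b ≤ d
    lower _ = projection-lower-bound least₁ least₂
    realised : Σ ℕ (λ s → ConnSubgraph (G □ H) S s × s ≤ a + b) → ConnSubgraph (G □ H) S (a + b)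
    realised (s , T , s≤a+b) = ≡.subst (ConnSubgraph (G □ H) S) (≤-antisym s≤a+b (lower s T)) T

  -- The goal is decidable, so the
  -- classical minimum is harmless.
  sdiam-bounded : ∀ {a b} → 3 ≤ n → 3 ≤ m → Connected G → Connected H →
                  IsSdiam 3 G a → IsSdiam 3 H b →
                  ∀ S d → KSubset 3 S → SteinerDist (G □ H) S d → d ≤ a + b
  sdiam-bounded {a} {b} 3≤n 3≤m conn-G conn-H sdiam-G sdiam-H
                ((g₁ , h₁) ∷ (g₂ , h₂) ∷ (g₃ , h₃) ∷ []) d (_ , refl) (_ , least) =
    decidable-stable (d ≤? a + b) λ d≰a+b →
      steiner-bound 3≤n conn-G sdiam-G g₁ g₂ g₃ λ (A , T₁ , A≤a) →
      steiner-bound 3≤m conn-H sdiam-H h₁ h₂ h₃ λ (B , T₂ , B≤b) →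
      let s , T , s≤A+B = product-subgraph T₁ T₂
      in  d≰a+b (≤-trans (least s T) (≤-trans s≤A+B (+-mono-≤ A≤a B≤b)))

corollary2p3 : (n m : ℕ) (G : FinGraph n) (H : FinGraph m) →
    3 ≤ n → 3 ≤ m → Connected G → Connected H →
    (a b : ℕ) → IsSdiam 3 G a → IsSdiam 3 H b → IsSdiam 3 (G □ H) (a + b)
corollary2p3 n m G H 3≤n 3≤m conn-G conn-H a b sdiam-G sdiam-H =
  sdiam-attained G H sdiam-G sdiam-H ,
  sdiam-bounded G H 3≤n 3≤m conn-G conn-H sdiam-G sdiam-H
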